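{- Let $n\geq 3$ and $1\leq t\leq n$ be integers. Then $\mathrm{dac}(\overrightarrow{C}_{n^2-n+t}[\overrightarrow{C}_n])\leq n^2$.
   Context: $\overrightarrow{C}_m$ is the directed cycle with vertex set $\mathbb{Z}_m$ and arcs $j\to j+1$. The lexicographic product $D[H]$ has vertex set $V(D)\times V(H)$, with an arc from $(u,a)$ to $(v,b)$ iff $uv\in A(D)$, or $u=v$ and $ab\in A(H)$. A coloring with $k$ colors is a surjection $V(D)\to[k]$. It is acyclic if every color class induces a subdigraph with no directed cycle, and complete if for every ordered pair $(i,j)$ of distinct colors there is an arc from a vertex colored $i$ to one colored $j$. $\mathrm{dac}(D)$ is the largest $k$ for which $D$ has an acyclic complete coloring with $k$ colors. -}

module Defs where

open import Data.Nat using (ℕ; suc; zero)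
open import Data.Fin using (Fin; toℕ)
open import Data.Product using (Σ; _×_; _,_; ∃)
open import Data.Sum using (_⊎_)
open import Relation.Binary.PropositionalEquality using (_≡_; _≢_)
open import Relation.Binary.Construct.Closure.Transitive using (TransClosure)
open import Relation.Nullary using (¬_)
open import Function.Definitions using (Surjective)

record Digraph : Set₁ where
  field
    V   : Set
    Arc : V → V → Set
open Digraph public

-- Directed cycle C_m on Z_m (represented by Fin m): arcs j → j+1 (mod m).
cycleArc : (m : ℕ) → Fin m → Fin m → Set
cycleArc m i j = (toℕ j ≡ suc (toℕ i)) ⊎ ((toℕ j ≡ 0) × (suc (toℕ i) ≡ m))

C⃗ : ℕ → Digraph
C⃗ m = record { V = Fin m ; Arc = cycleArc m }

lexArc : (D H : Digraph) → V D × V H → V D × V H → Set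
lexArc D H (u , a) (v , b) = Arc D u v ⊎ ((u ≡ v) × Arc H a b)

_[_] : Digraph → Digraph → Digraph
D [ H ] = record { V = V D × V H ; Arc = lexArc D H }

classArc : (D : Digraph) {k : ℕ} → (V D → Fin k) → Fin k → V D → V D → Set
classArc D c i u v = (c u ≡ i) × (c v ≡ i) × Arc D u v

IsColoring : (D : Digraph) (k : ℕ) → (V D → Fin k) → Set
IsColoring D k c = Surjective _≡_ _≡_ c

-- Acyclic: no colour class induces a directed cycle
-- (equivalently, no closed directed walk of positive length inside the class).
IsAcyclic : (D : Digraph) {k : ℕ} → (V D → Fin k) → Set
IsAcyclic D c = ∀ i v → ¬ TransClosure (classArc D c i) v v

IsComplete : (D : Digraph) {k : ℕ} → (V D → Fin k) → Set
IsComplete D c = ∀ i j → i ≢ j →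
  Σ (V D) λ u → Σ (V D) λ v → Arc D u v × (c u ≡ i) × (c v ≡ j)

IsAcyclicComplete : (D : Digraph) (k : ℕ) → (V D → Fin k) → Set
IsAcyclicComplete D k c = IsColoring D k c × IsAcyclic D c × IsComplete D c

-- "dac(D) ≤ b": every acyclic complete coloring of D uses at most b colours.
dac≤ : Digraph → ℕ → Set
dac≤ D b = ∀ (k : ℕ) (c : V D → Fin k) → IsAcyclicComplete D k c → k Data.Nat.≤ b

{-# OPTIONS --safe #-}

-- In a complete colouring with k colours, a colour class S has arcs into each of the
-- other k - 1 classes, so k ≤ 1 + |S|·Δ⁺ where Δ⁺ is the maximum out-degree.  In
-- C_m[C_n] every vertex has out-degree n + 1, so if k > n² every class has at least n
-- vertices, and summing over the classes gives kn ≤ mn ≤ n³, i.e. k ≤ n².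

module Submission where

open import Defs
open import Data.Nat using (ℕ; _≤_; _*_; _∸_; _+_)
open import Data.Nat.Base using (suc; zero; _<_; z≤n; s≤s; NonZero; >-nonZero)
open import Data.Nat.Properties
  using ( ≤-refl; ≤-trans; ≤-reflexive; <-irrefl; ≮⇒≥; _≤?_; _<?_; +-mono-≤; +-monoʳ-≤
        ; *-monoˡ-≤; *-cancelʳ-≤; *-identityˡ; m≤m*n; m∸n+n≡m; +-0-commutativeMonoid
        ; module ≤-Reasoning)
open import Data.Fin.Base using (Fin; zero; suc; toℕ; fromℕ<; punchIn)
open import Data.Fin.Properties using (_≟_; toℕ-injective; toℕ-fromℕ<; toℕ<n; injective⇒≤; punchInᵢ≢i)
open import Data.List.Base using (List; []; _∷_; map; length; _++_; concatMap; filter; cartesianProduct; allFin)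
open import Data.List.Properties using (length-map; length-++; length-tabulate)
open import Data.List.Relation.Unary.Any using (here; there)
open import Data.List.Membership.Propositional using (_∈_; lose)
open import Data.List.Membership.Propositional.Properties
  using (∈-map⁺; ∈-++⁺ˡ; ∈-++⁺ʳ; ∈-allFin; ∈-concatMap⁺; ∈-filter⁺; ∈-cartesianProduct⁺)
open import Data.List.Relation.Unary.Enumerates.Setoid using (IsEnumeration)
open import Data.List.Relation.Unary.Enumerates.Setoid.Properties using (lookup-surjective)
open import Data.Product using (_×_; _,_; proj₁; proj₂)
open import Data.Sum using (inj₁; inj₂)
open import Data.Bool.Base using (if_then_else_)
open import Data.Empty using (⊥-elim)
open import Relation.Nullary using (yes; no; does)
open import Relation.Binary.PropositionalEquality
  using (_≡_; refl; sym; trans; cong; cong₂; subst; setoid; module ≡-Reasoning)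
open import Function.Definitions using (Surjective)
open import Algebra.Properties.CommutativeMonoid.Sum +-0-commutativeMonoid
  using (sum-syntax; sum-remove; sum-cong-≗; sum-replicate-zero; ∑-distrib-+)
open import Data.Nat.Solver using (module +-*-Solver)

Enumerates : {A : Set} → List A → Set
Enumerates {A} = IsEnumeration (setoid A)

surjective⇒≤ : ∀ {m n} {f : Fin m → Fin n} → Surjective _≡_ _≡_ f → n ≤ m
surjective⇒≤ {f = f} surj = injective⇒≤ section-injective
  where
  f∘section : ∀ y → f (proj₁ (surj y)) ≡ y
  f∘section y = proj₂ (surj y) refl

  section-injective : ∀ {x y} → proj₁ (surj x) ≡ proj₁ (surj y) → x ≡ y
  section-injective {x} {y} eq = trans (sym (f∘section x)) (trans (cong f eq) (f∘section y))

enumeration⇒≤length : ∀ {k} {xs : List (Fin k)} → Enumerates xs → k ≤ length xs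
enumeration⇒≤length e = surjective⇒≤ (lookup-surjective (setoid _) e)

length-cartesianProduct : ∀ {A B : Set} (xs : List A) (ys : List B) →
  length (cartesianProduct xs ys) ≡ length xs * length ys
length-cartesianProduct [] ys = refl
length-cartesianProduct (x ∷ xs) ys = begin
  length (map (x ,_) ys ++ cartesianProduct xs ys)          ≡⟨ length-++ (map (x ,_) ys) ⟩
  length (map (x ,_) ys) + length (cartesianProduct xs ys)
    ≡⟨ cong₂ _+_ (length-map (x ,_) ys) (length-cartesianProduct xs ys) ⟩
  length ys + length xs * length ys                         ∎
  where open ≡-Reasoning

length-concatMap-≤ : ∀ {A B : Set} {d} (f : A → List B) → (∀ x → length (f x) ≤ d) →
  ∀ xs → length (concatMap f xs) ≤ length xs * d
length-concatMap-≤ f bounded [] = z≤n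
length-concatMap-≤ f bounded (x ∷ xs) = begin
  length (f x ++ concatMap f xs)          ≡⟨ length-++ (f x) ⟩
  length (f x) + length (concatMap f xs)  ≤⟨ +-mono-≤ (bounded x) (length-concatMap-≤ f bounded xs) ⟩
  _ + length xs * _                       ∎
  where open ≤-Reasoning

cartesianProduct-enumerates : ∀ {A B : Set} {xs : List A} {ys : List B} →
  Enumerates xs → Enumerates ys → Enumerates (cartesianProduct xs ys)
cartesianProduct-enumerates enum-xs enum-ys (x , y) = ∈-cartesianProduct⁺ (enum-xs x) (enum-ys y)

colourClass : {A : Set} {k : ℕ} → (A → Fin k) → Fin k → List A → List A
colourClass c i = filter (λ x → c x ≟ i)

indicator : ∀ {k} → Fin k → Fin k → ℕ
indicator j i = if does (j ≟ i) then 1 else 0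

∑-indicator : ∀ {k} (j : Fin k) → ∑[ i < k ] indicator j i ≡ 1
∑-indicator {suc k} j = begin
  ∑[ i < suc k ] indicator j i                          ≡⟨ sum-remove {i = j} (indicator j) ⟩
  indicator j j + ∑[ i < k ] indicator j (punchIn j i)  ≡⟨ cong₂ _+_ (on-diagonal j) (sum-cong-≗ (off-diagonal j)) ⟩
  1 + ∑[ i < k ] 0                                      ≡⟨ cong suc (sum-replicate-zero k) ⟩
  1                                                     ∎
  where
  open ≡-Reasoning

  on-diagonal : ∀ j → indicator j j ≡ 1
  on-diagonal j with j ≟ j
  ... | yes _  = refl
  ... | no j≢j = ⊥-elim (j≢j refl)

  off-diagonal : ∀ j i → indicator j (punchIn j i) ≡ 0
  off-diagonal j i with j ≟ punchIn j i
  ... | yes j≡ = ⊥-elim (punchInᵢ≢i j i (sym j≡))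
  ... | no _   = refl

length-colourClass-∷ : ∀ {A : Set} {k} (c : A → Fin k) x xs i →
  length (colourClass c i (x ∷ xs)) ≡ indicator (c x) i + length (colourClass c i xs)
length-colourClass-∷ c x xs i with c x ≟ i
... | yes _ = refl
... | no _  = refl

∑-length-colourClass : ∀ {A : Set} {k} (c : A → Fin k) xs →
  ∑[ i < k ] length (colourClass c i xs) ≡ length xs
∑-length-colourClass {k = k} c [] = sum-replicate-zero k
∑-length-colourClass {k = k} c (x ∷ xs) = begin
  ∑[ i < k ] length (colourClass c i (x ∷ xs))
    ≡⟨ sum-cong-≗ (length-colourClass-∷ c x xs) ⟩
  ∑[ i < k ] (indicator (c x) i + length (colourClass c i xs))
    ≡⟨ ∑-distrib-+ (indicator (c x)) (λ i → length (colourClass c i xs)) ⟩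
  ∑[ i < k ] indicator (c x) i + ∑[ i < k ] length (colourClass c i xs)
    ≡⟨ cong₂ _+_ (∑-indicator (c x)) (∑-length-colourClass c xs) ⟩
  suc (length xs)                                              ∎
  where open ≡-Reasoning

*-≤-∑ : ∀ {k s} (f : Fin k → ℕ) → (∀ i → s ≤ f i) → k * s ≤ ∑[ i < k ] f i
*-≤-∑ {zero}  f s≤f = ≤-refl
*-≤-∑ {suc k} f s≤f = +-mono-≤ (s≤f zero) (*-≤-∑ (λ i → f (suc i)) (λ i → s≤f (suc i)))

OutNeighbours : (D : Digraph) → (V D → List (V D)) → Set
OutNeighbours D out = ∀ {u v} → Arc D u v → v ∈ out u

module _ (D : Digraph) {k : ℕ} {c : V D → Fin k} (complete : IsComplete D c)
         {out : V D → List (V D)} (out-complete : OutNeighbours D out) where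

  coloursOfOutNeighbours-enumerates : ∀ i (xs : List (V D)) → (∀ {u} → c u ≡ i → u ∈ xs) →
    Enumerates (i ∷ map c (concatMap out xs))
  coloursOfOutNeighbours-enumerates i xs class⊆xs j with i ≟ j
  ... | yes refl = here refl
  ... | no i≢j with u , v , u→v , cu≡i , refl ← complete i j i≢j =
    there (∈-map⁺ c (∈-concatMap⁺ out (lose (class⊆xs cu≡i) (out-complete u→v))))

  complete⇒≤1+size*outdegree : ∀ {d} → (∀ u → length (out u) ≤ d) →
    ∀ i (xs : List (V D)) → (∀ {u} → c u ≡ i → u ∈ xs) → k ≤ suc (length xs * d)
  complete⇒≤1+size*outdegree bounded i xs class⊆xs = begin
    k                                        ≤⟨ enumeration⇒≤length (coloursOfOutNeighbours-enumerates i xs class⊆xs) ⟩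
    suc (length (map c (concatMap out xs)))  ≡⟨ cong suc (length-map c (concatMap out xs)) ⟩
    suc (length (concatMap out xs))          ≤⟨ s≤s (length-concatMap-≤ out bounded xs) ⟩
    suc (length xs * _)                      ∎
    where open ≤-Reasoning

<⇒1+m*[1+n]≤n*n : ∀ {m n} → m < n → suc (m * suc n) ≤ n * n
<⇒1+m*[1+n]≤n*n {m} {suc p} (s≤s m≤p) = begin
  suc (m * suc (suc p)) ≤⟨ s≤s (*-monoˡ-≤ (suc (suc p)) m≤p) ⟩
  suc (p * suc (suc p)) ≡⟨ square-of-suc p ⟩
  suc p * suc p         ∎
  where
  open ≤-Reasoning
  open +-*-Solver

  square-of-suc : ∀ p → suc (p * suc (suc p)) ≡ suc p * suc p
  square-of-suc = solve 1 (λ p → con 1 :+ p :* (con 2 :+ p) := (con 1 :+ p) :* (con 1 :+ p)) refl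

complete⇒≤square : ∀ (D : Digraph) n .{{_ : NonZero n}} {vs : List (V D)} {out : V D → List (V D)} →
  Enumerates vs → length vs ≤ n * n * n →
  OutNeighbours D out → (∀ u → length (out u) ≤ suc n) →
  ∀ {k} {c : V D → Fin k} → IsComplete D c → k ≤ n * n
complete⇒≤square D n {vs} enum few-vertices out-complete bounded {k} {c} complete with k ≤? n * n
... | yes k≤n² = k≤n²
... | no k≰n² = *-cancelʳ-≤ k (n * n) n (begin
    k * n                   ≤⟨ *-≤-∑ classSize large-class ⟩
    ∑[ i < k ] classSize i  ≡⟨ ∑-length-colourClass c vs ⟩
    length vs               ≤⟨ few-vertices ⟩
    n * n * n               ∎)
  where
  open ≤-Reasoning

  classSize : Fin k → ℕ
  classSize i = length (colourClass c i vs)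

  k≤1+size*[1+n] : ∀ i → k ≤ suc (classSize i * suc n)
  k≤1+size*[1+n] i = complete⇒≤1+size*outdegree D complete out-complete bounded i (colourClass c i vs)
    (λ cu≡i → ∈-filter⁺ (λ x → c x ≟ i) (enum _) cu≡i)

  large-class : ∀ i → n ≤ classSize i
  large-class i = ≮⇒≥ (λ size<n → k≰n² (≤-trans (k≤1+size*[1+n] i) (<⇒1+m*[1+n]≤n*n size<n)))

module _ (D H : Digraph) where

  lexOut : (V D → List (V D)) → (V H → List (V H)) → List (V H) → V D × V H → List (V D × V H)
  lexOut outD outH vsH (u , a) = map (u ,_) (outH a) ++ cartesianProduct (outD u) vsH

  lexOut-outNeighbours : ∀ {outD outH vsH} → OutNeighbours D outD → OutNeighbours H outH →
    Enumerates vsH → OutNeighbours (D [ H ]) (lexOut outD outH vsH)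
  lexOut-outNeighbours outD-complete outH-complete enum {u , a} {v , b} (inj₁ u→v) =
    ∈-++⁺ʳ _ (∈-cartesianProduct⁺ (outD-complete u→v) (enum b))
  lexOut-outNeighbours outD-complete outH-complete enum {u , a} {.u , b} (inj₂ (refl , a→b)) =
    ∈-++⁺ˡ (∈-map⁺ (u ,_) (outH-complete a→b))

  length-lexOut-≤ : ∀ outD outH vsH {dD dH} → (∀ u → length (outD u) ≤ dD) → (∀ a → length (outH a) ≤ dH) →
    ∀ x → length (lexOut outD outH vsH x) ≤ dH + dD * length vsH
  length-lexOut-≤ outD outH vsH {dD} {dH} outD-bounded outH-bounded (u , a) = begin
    length (map (u ,_) (outH a) ++ cartesianProduct (outD u) vsH)          ≡⟨ length-++ (map (u ,_) (outH a)) ⟩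
    length (map (u ,_) (outH a)) + length (cartesianProduct (outD u) vsH)
      ≡⟨ cong₂ _+_ (length-map (u ,_) (outH a)) (length-cartesianProduct (outD u) vsH) ⟩
    length (outH a) + length (outD u) * length vsH
      ≤⟨ +-mono-≤ (outH-bounded a) (*-monoˡ-≤ (length vsH) (outD-bounded u)) ⟩
    dH + dD * length vsH                                                   ∎
    where open ≤-Reasoning

cyclicSuc : ∀ {m} → Fin m → Fin m
cyclicSuc {suc m} u with suc (toℕ u) <? suc m
... | yes 1+u<1+m = fromℕ< 1+u<1+m
... | no _        = zero

cycleArc⇒≡cyclicSuc : ∀ {m} {u v : Fin m} → cycleArc m u v → v ≡ cyclicSuc u
cycleArc⇒≡cyclicSuc {suc m} {u} {v} arc with suc (toℕ u) <? suc m | arc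
... | yes 1+u<1+m | inj₁ v≡1+u        = toℕ-injective (trans v≡1+u (sym (toℕ-fromℕ< 1+u<1+m)))
... | yes 1+u<1+m | inj₂ (_ , 1+u≡1+m) = ⊥-elim (<-irrefl 1+u≡1+m 1+u<1+m)
... | no 1+u≮1+m  | inj₁ v≡1+u        = ⊥-elim (1+u≮1+m (subst (_< suc m) v≡1+u (toℕ<n v)))
... | no _        | inj₂ (v≡0 , _)    = toℕ-injective v≡0

cycleOut : ∀ m → Fin m → List (Fin m)
cycleOut m u = cyclicSuc u ∷ []

cycle-outNeighbours : ∀ m → OutNeighbours (C⃗ m) (cycleOut m)
cycle-outNeighbours m arc = here (cycleArc⇒≡cyclicSuc arc)

cycle[cycle]-complete⇒≤square : ∀ m n .{{_ : NonZero n}} → m ≤ n * n →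
  ∀ {k} {c : Fin m × Fin n → Fin k} → IsComplete (C⃗ m [ C⃗ n ]) c → k ≤ n * n
cycle[cycle]-complete⇒≤square m n m≤n² =
  complete⇒≤square (C⃗ m [ C⃗ n ]) n
    (cartesianProduct-enumerates ∈-allFin ∈-allFin) vertex-count
    (lexOut-outNeighbours (C⃗ m) (C⃗ n) (cycle-outNeighbours m) (cycle-outNeighbours n) ∈-allFin)
    outdegree
  where
  open ≤-Reasoning

  length-allFin : ∀ n → length (allFin n) ≡ n
  length-allFin n = length-tabulate {n = n} (λ i → i)

  vertex-count : length (cartesianProduct (allFin m) (allFin n)) ≤ n * n * n
  vertex-count = begin
    length (cartesianProduct (allFin m) (allFin n)) ≡⟨ length-cartesianProduct (allFin m) (allFin n) ⟩
    length (allFin m) * length (allFin n)           ≡⟨ cong₂ _*_ (length-allFin m) (length-allFin n) ⟩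
    m * n                                           ≤⟨ *-monoˡ-≤ n m≤n² ⟩
    n * n * n                                       ∎

  outdegree : ∀ x → length (lexOut (C⃗ m) (C⃗ n) (cycleOut m) (cycleOut n) (allFin n) x) ≤ suc n
  outdegree x = ≤-trans (length-lexOut-≤ (C⃗ m) (C⃗ n) (cycleOut m) (cycleOut n) (allFin n)
                                                 (λ _ → ≤-refl) (λ _ → ≤-refl) x)
                        (≤-reflexive (cong suc (trans (*-identityˡ _) (length-allFin n))))

corollary8 : (n t : ℕ) → 3 ≤ n → 1 ≤ t → t ≤ n →
    dac≤ (C⃗ (n * n ∸ n + t) [ C⃗ n ]) (n * n)
corollary8 n t 3≤n _ t≤n k c (_ , _ , complete) =
  cycle[cycle]-complete⇒≤square (n * n ∸ n + t) n m≤n² complete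
  where
  instance
    n≢0 : NonZero n
    n≢0 = >-nonZero (≤-trans (s≤s z≤n) 3≤n)

  m≤n² : n * n ∸ n + t ≤ n * n
  m≤n² = ≤-trans (+-monoʳ-≤ (n * n ∸ n) t≤n) (≤-reflexive (m∸n+n≡m (m≤m*n n n)))
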